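{- Let $(a,b)$ and $(a',b)$ be two different digraphic lists of length $n$ such that $a$ is nonincreasing and $a\prec a'$. Then $N_2(a,b)\ge N_2(a',b)$.
   Context: $(a,b)$ denotes $((a_1,b_1),\dots,(a_n,b_n))$ with nonnegative integers. A digraph realization is a digraph without loops and without multiple arcs on labeled vertices $v_1,\dots,v_n$ with indegree $a_i$ and outdegree $b_i$ at $v_i$; $(a,b)$ is digraphic if one exists and $N_2(a,b)$ is the number of them. Majorization: $a\prec a'$ iff $\sum_{i=1}^k a_i\le\sum_{i=1}^k a'_i$ for $k=1,\dots,n-1$ and total sums are equal (partial sums in the given order). -}

module Defs where

open import Data.Nat using (ℕ; zero; suc; _+_; _≤_; _<_)
import Data.Nat as ℕ
open import Data.Bool using (Bool; true; false; if_then_else_)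
import Data.Bool.Properties as BoolP
open import Data.Fin using (Fin)
import Data.Fin as Fin
import Data.Fin.Properties as FinP
open import Data.Vec using (Vec; []; _∷_; lookup; toList)
import Data.Vec as Vec
open import Data.List using (List; length; filter; concatMap; take)
open import Data.Nat.ListAction using (sum)
import Data.List as List
open import Data.Product using (Σ; _×_; ∃; _,_)
open import Relation.Binary.PropositionalEquality using (_≡_)
open import Relation.Nullary using (Dec)
open import Relation.Nullary.Decidable using (_×-dec_)

DegList : ℕ → Set
DegList n = Vec ℕ n

-- A digraph on labelled vertices v_1..v_n (here Fin n) without multiple arcs,
-- given by its 0/1 adjacency matrix: M[i][j] = true  iff  there is an arc v_i → v_j.
Digraph : ℕ → Set
Digraph n = Vec (Vec Bool n) n

arc : ∀ {n} → Digraph n → Fin n → Fin n → Bool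
arc M i j = lookup (lookup M i) j

countTrue : ∀ {m} → Vec Bool m → ℕ
countTrue [] = 0
countTrue (true ∷ xs) = suc (countTrue xs)
countTrue (false ∷ xs) = countTrue xs

outdeg : ∀ {n} → Digraph n → Fin n → ℕ
outdeg M i = countTrue (lookup M i)

indeg : ∀ {n} → Digraph n → Fin n → ℕ
indeg M j = countTrue (Vec.map (λ row → lookup row j) M)

Loopless : ∀ {n} → Digraph n → Set
Loopless {n} M = ∀ (i : Fin n) → arc M i i ≡ false

IsRealization : ∀ {n} → DegList n → DegList n → Digraph n → Set
IsRealization {n} a b M =
  Loopless M
  × (∀ (i : Fin n) → indeg M i ≡ lookup a i)
  × (∀ (i : Fin n) → outdeg M i ≡ lookup b i)

isRealization? : ∀ {n} (a b : DegList n) (M : Digraph n) → Dec (IsRealization a b M)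
isRealization? a b M =
  FinP.all? (λ i → BoolP._≟_ (arc M i i) false)
  ×-dec FinP.all? (λ i → ℕ._≟_ (indeg M i) (lookup a i))
  ×-dec FinP.all? (λ i → ℕ._≟_ (outdeg M i) (lookup b i))

Digraphic : ∀ {n} → DegList n → DegList n → Set
Digraphic {n} a b = Σ (Digraph n) (IsRealization a b)

allVecs : ∀ {A : Set} → List A → (m : ℕ) → List (Vec A m)
allVecs xs zero = List._∷_ [] List.[]
allVecs xs (suc m) = concatMap (λ x → List.map (x ∷_) (allVecs xs m)) xs

allDigraphs : (n : ℕ) → List (Digraph n)
allDigraphs n = allVecs (allVecs (List._∷_ true (List._∷_ false List.[])) n) n

N₂ : ∀ {n} → DegList n → DegList n → ℕ
N₂ {n} a b = length (filter (isRealization? a b) (allDigraphs n))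

psum : ∀ {n} → ℕ → DegList n → ℕ
psum k a = sum (take k (toList a))

total : ∀ {n} → DegList n → ℕ
total a = sum (toList a)

_≺_ : ∀ {n} → DegList n → DegList n → Set
_≺_ {n} a a' = (∀ k → 1 ≤ k → k < n → psum k a ≤ psum k a') × total a ≡ total a'

Nonincreasing : ∀ {n} → DegList n → Set
Nonincreasing {n} a = ∀ (i j : Fin n) → i Fin.≤ j → lookup a j ≤ lookup a i

-- Since a is nonincreasing and a ≺ a′, one gets from a′ to a by Robin Hood transfers: moving
-- one unit of in-degree from a vertex i to a vertex j that afterwards still has in-degree at most
-- that of i.  So it suffices to inject the realizations of c′ into those of c when c arises from
-- c′ by one such transfer, c_j ≤ c_i.  In a realization of c′ column i has e + 2 more arcs than
-- column j, where e = c_i − c_j.  Go down the rows x ∉ {i, j}, adding [x→i] − [x→j] ∈ {−1, 0, 1}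
-- to a running sum that starts with the contribution of rows i and j, at most 1 as there are no
-- loops.  From the first row at which the sum equals e + 1 on, swap the entries i and j in every
-- row outside {i, j}.  This reflects the rest of the walk, so the column difference becomes e,
-- while loops, out-degrees, the column sum i + j and all other columns are unchanged.  The map is
-- an involution on all 0/1 matrices, hence injective.

module Submission where

open import Data.Nat as ℕ using (ℕ; zero; suc)
import Data.Nat.Properties as ℕP
open import Data.Bool using (Bool; true; false)
open import Data.Fin using (Fin; zero; suc; _≟_)
open import Data.Vec using (Vec; []; _∷_; lookup)
open import Data.Vec.Properties using (∷-injective)
open import Data.List using (List; []; _∷_; _++_; length; filter; concatMap; cartesianProductWith)
import Data.List as List
open import Data.List.Properties using (length-++; length-map)
open import Data.List.Membership.Propositional using (_∈_)
open import Data.List.Membership.Propositional.Properties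
  using (∈-∃++; ∈-++⁻; ∈-++⁺ˡ; ∈-++⁺ʳ; ∈-map⁻; ∈-filter⁺; ∈-filter⁻;
         ∈-cartesianProductWith⁺)
open import Data.List.Relation.Binary.Subset.Propositional using (_⊆_)
open import Data.List.Relation.Unary.Any using (here; there)
open import Data.List.Relation.Unary.All using ([]; _∷_)
import Data.List.Relation.Unary.All as All
open import Data.List.Relation.Unary.AllPairs using ([]; _∷_)
open import Data.List.Relation.Unary.Unique.Propositional using (Unique)
open import Data.List.Relation.Unary.Unique.Propositional.Properties
  using (map⁺; filter⁺; cartesianProductWith⁺)
open import Data.Product using (Σ; _×_; _,_; proj₁; proj₂)
open import Data.Sum using (_⊎_; inj₁; inj₂)
open import Data.Empty using (⊥-elim)
open import Function using (_∘_; id; const; Injective)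
open import Relation.Binary.PropositionalEquality
open import Relation.Nullary using (yes; no; ¬_)
open import Relation.Unary using (Pred; Decidable)
open import Relation.Binary.Construct.Closure.ReflexiveTransitive using (Star; ε; _◅_; gmap; fold)
open import Defs

-- Counting realizations

Unique∧⊆⇒length≤ : ∀ {A : Set} {xs ys : List A} → Unique xs → xs ⊆ ys → length xs ℕ.≤ length ys
Unique∧⊆⇒length≤ {xs = []} _ _ = ℕ.z≤n
Unique∧⊆⇒length≤ {xs = x ∷ xs} {ys} (x∉xs ∷ xs!) xs⊆ys with ∈-∃++ (xs⊆ys (here refl))
... | us , vs , refl =
  ℕP.≤-trans (ℕ.s≤s (Unique∧⊆⇒length≤ xs! xs⊆us++vs)) (ℕP.≤-reflexive (sym length-us++x∷vs))
  where
  xs⊆us++vs : xs ⊆ us ++ vs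
  xs⊆us++vs {y} y∈xs with ∈-++⁻ us (xs⊆ys (there y∈xs))
  ... | inj₁ y∈us = ∈-++⁺ˡ y∈us
  ... | inj₂ (here refl) = ⊥-elim (All.lookup x∉xs y∈xs refl)
  ... | inj₂ (there y∈vs) = ∈-++⁺ʳ us y∈vs
  length-us++x∷vs : length (us ++ x ∷ vs) ≡ suc (length (us ++ vs))
  length-us++x∷vs =
    trans (length-++ us) (trans (ℕP.+-suc (length us) (length vs)) (cong suc (sym (length-++ us))))

length-filter-≤-by-injection :
  ∀ {A : Set} {p q} {P : Pred A p} {Q : Pred A q} (P? : Decidable P) (Q? : Decidable Q) {xs : List A} →
  Unique xs → (∀ x → x ∈ xs) → (f : A → A) → Injective _≡_ _≡_ f → (∀ {x} → P x → Q (f x)) →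
  length (filter P? xs) ℕ.≤ length (filter Q? xs)
length-filter-≤-by-injection P? Q? {xs} xs! complete f f-inj P⇒Q =
  ℕP.≤-trans (ℕP.≤-reflexive (sym (length-map f (filter P? xs))))
             (Unique∧⊆⇒length≤ (map⁺ f-inj (filter⁺ P? {xs} xs!)) image⊆)
  where
  image⊆ : List.map f (filter P? xs) ⊆ filter Q? xs
  image⊆ y∈ with ∈-map⁻ f y∈
  ... | x , x∈ , refl = ∈-filter⁺ Q? (complete (f x)) (P⇒Q (proj₂ (∈-filter⁻ P? {xs = xs} x∈)))

concatMap-∷≡cartesianProductWith : ∀ {A : Set} {m} (xs : List A) (vs : List (Vec A m)) →
  concatMap (λ x → List.map (x ∷_) vs) xs ≡ cartesianProductWith _∷_ xs vs
concatMap-∷≡cartesianProductWith [] vs = refl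
concatMap-∷≡cartesianProductWith (x ∷ xs) vs =
  cong (List.map (x ∷_) vs ++_) (concatMap-∷≡cartesianProductWith xs vs)

allVecs-unique : ∀ {A : Set} {xs : List A} → Unique xs → ∀ m → Unique (allVecs xs m)
allVecs-unique xs! zero = [] ∷ []
allVecs-unique {xs = xs} xs! (suc m) rewrite concatMap-∷≡cartesianProductWith xs (allVecs xs m) =
  cartesianProductWith⁺ _∷_ ∷-injective xs! (allVecs-unique xs! m)

allVecs-complete : ∀ {A : Set} {xs : List A} → (∀ x → x ∈ xs) → ∀ {m} (v : Vec A m) → v ∈ allVecs xs m
allVecs-complete complete [] = here refl
allVecs-complete {xs = xs} complete {suc m} (x ∷ v)
  rewrite concatMap-∷≡cartesianProductWith xs (allVecs xs m) =
  ∈-cartesianProductWith⁺ _∷_ (complete x) (allVecs-complete complete v)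

allDigraphs-unique : ∀ n → Unique (allDigraphs n)
allDigraphs-unique n = allVecs-unique (allVecs-unique (((λ ()) ∷ []) ∷ [] ∷ []) n) n

allDigraphs-complete : ∀ {n} (M : Digraph n) → M ∈ allDigraphs n
allDigraphs-complete = allVecs-complete (allVecs-complete λ { true → here refl ; false → there (here refl) })

N₂-mono-by-injection : ∀ {n} {a b a′ b′ : DegList n} (f : Digraph n → Digraph n) → Injective _≡_ _≡_ f →
  (∀ M → IsRealization a b M → IsRealization a′ b′ (f M)) → N₂ a b ℕ.≤ N₂ a′ b′
N₂-mono-by-injection {n} f f-inj realizes =
  length-filter-≤-by-injection _ _ (allDigraphs-unique n) allDigraphs-complete f f-inj (realizes _)

-- A single Robin Hood transfer

record RobinHood {n} (c′ c : DegList n) : Set where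
  field
    from to : Fin n
    from≢to : from ≢ to
    from-decreases : lookup c′ from ≡ suc (lookup c from)
    to-increases : lookup c to ≡ suc (lookup c′ to)
    others-unchanged : ∀ k → k ≢ from → k ≢ to → lookup c k ≡ lookup c′ k
    to≤from : lookup c to ℕ.≤ lookup c from

module ColumnSwitching where

  import Data.Nat.Tactic.RingSolver as ℕ-Solver
  open import Data.Integer using (ℤ; +_; _+_; _-_; -_; _≤_; _<_; 0ℤ; 1ℤ; +≤+; -≤+; +<+)
  import Data.Integer as ℤ
  import Data.Integer.Properties as ℤP
  open import Data.Integer.Tactic.RingSolver using (solve-∀)
  open import Algebra.Properties.CommutativeMonoid.Sum ℤP.+-0-commutativeMonoid
    using (sum; sum-syntax; sum-remove; sum-cong-≗; ∑-distrib-+; sum-permute)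
  open import Data.Fin using (punchIn)
  open import Data.Fin.Properties using (punchInᵢ≢i)
  import Data.Fin.Permutation as Perm
  import Data.Fin.Permutation.Components as PC
  open import Data.Vec using (tabulate; map)
  open import Data.Vec.Properties using (lookup∘tabulate; tabulate∘lookup; tabulate-cong; lookup-map)
  open import Data.Vec.Functional using (Vector; updateAt; removeAt)
  open import Data.Vec.Functional.Properties using (updateAt-updates; updateAt-minimal)
  open import Relation.Nullary.Decidable using (_⊎-dec_)

  toℤ : Bool → ℤ
  toℤ true = 1ℤ
  toℤ false = 0ℤ

  countTrue≡∑ : ∀ {m} (v : Vec Bool m) → + countTrue v ≡ ∑[ k < m ] toℤ (lookup v k)
  countTrue≡∑ [] = refl
  countTrue≡∑ (true ∷ v) = cong (λ z → 1ℤ + z) (countTrue≡∑ v)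
  countTrue≡∑ (false ∷ v) = trans (countTrue≡∑ v) (sym (ℤP.+-identityˡ _))

  indeg≡∑ : ∀ {n} (M : Digraph n) k → + indeg M k ≡ ∑[ x < n ] toℤ (arc M x k)
  indeg≡∑ M k = trans (countTrue≡∑ (map (λ row → lookup row k) M))
    (sum-cong-≗ λ x → cong toℤ (lookup-map x (λ row → lookup row k) M))

  sum-isolate : ∀ {n} (t : Vector ℤ n) k → sum t ≡ t k + sum (updateAt t k (const 0ℤ))
  sum-isolate {suc n} t k = begin
    sum t                              ≡⟨ sum-remove t ⟩
    t k + sum (removeAt t k)           ≡⟨ cong (λ z → t k + z) (sum-cong-≗ untouched) ⟨
    t k + sum (removeAt t′ k)          ≡⟨ cong (λ z → t k + z) t′ₖ-vanishes ⟨
    t k + (t′ k + sum (removeAt t′ k)) ≡⟨ cong (λ z → t k + z) (sum-remove t′) ⟨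
    t k + sum t′                       ∎
    where
    open ≡-Reasoning
    t′ = updateAt t k (const 0ℤ)
    t′ₖ-vanishes : t′ k + sum (removeAt t′ k) ≡ sum (removeAt t′ k)
    t′ₖ-vanishes = trans (cong (_+ sum (removeAt t′ k)) (updateAt-updates k t)) (ℤP.+-identityˡ _)
    untouched : ∀ p → t′ (punchIn k p) ≡ t (punchIn k p)
    untouched p = updateAt-minimal (punchIn k p) k t (punchInᵢ≢i k p)

  module Reflection {I A : Set} (flip : I → A → A) (w : I → A → ℤ) (L : ℤ) where

    flipAll : ∀ {m} → (Fin m → I) → Vec A m → Vec A m
    flipAll ix [] = []
    flipAll ix (a ∷ as) = flip (ix zero) a ∷ flipAll (ix ∘ suc) as

    reflect : ∀ {m} → ℤ → (Fin m → I) → Vec A m → Vec A m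
    reflect v ix [] = []
    reflect v ix (a ∷ as) with v ℤ.≟ L
    ... | yes _ = flipAll ix (a ∷ as)
    ... | no _ = a ∷ reflect (v + w (ix zero) a) (ix ∘ suc) as

    weight : ∀ {m} → (Fin m → I) → Vec A m → ℤ
    weight {m} ix as = ∑[ p < m ] w (ix p) (lookup as p)

    reflect-hit : ∀ {m} {v} (ix : Fin (suc m) → I) a as → v ≡ L →
      reflect v ix (a ∷ as) ≡ flipAll ix (a ∷ as)
    reflect-hit {v = v} ix a as v≡L with v ℤ.≟ L
    ... | yes _ = refl
    ... | no v≢L = ⊥-elim (v≢L v≡L)

    reflect-miss : ∀ {m} {v} (ix : Fin (suc m) → I) a as → v ≢ L →
      reflect v ix (a ∷ as) ≡ a ∷ reflect (v + w (ix zero) a) (ix ∘ suc) as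
    reflect-miss {v = v} ix a as v≢L with v ℤ.≟ L
    ... | yes v≡L = ⊥-elim (v≢L v≡L)
    ... | no _ = refl

    module _ (flip-involutive : ∀ x a → flip x (flip x a) ≡ a) where

      flipAll-involutive : ∀ {m} (ix : Fin m → I) as → flipAll ix (flipAll ix as) ≡ as
      flipAll-involutive ix [] = refl
      flipAll-involutive ix (a ∷ as) = cong₂ _∷_ (flip-involutive (ix zero) a) (flipAll-involutive (ix ∘ suc) as)

      reflect-involutive : ∀ {m} v (ix : Fin m → I) as → reflect v ix (reflect v ix as) ≡ as
      reflect-involutive v ix [] = refl
      reflect-involutive v ix (a ∷ as) with v ℤ.≟ L
      ... | yes v≡L = begin
        reflect v ix (flipAll ix (a ∷ as)) ≡⟨ reflect-hit ix _ _ v≡L ⟩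
        flipAll ix (flipAll ix (a ∷ as))   ≡⟨ flipAll-involutive ix (a ∷ as) ⟩
        a ∷ as                             ∎
        where open ≡-Reasoning
      ... | no v≢L = begin
        reflect v ix (a ∷ reflect v′ (ix ∘ suc) as)            ≡⟨ reflect-miss ix _ _ v≢L ⟩
        a ∷ reflect v′ (ix ∘ suc) (reflect v′ (ix ∘ suc) as)
          ≡⟨ cong (a ∷_) (reflect-involutive v′ (ix ∘ suc) as) ⟩
        a ∷ as                                                 ∎
        where open ≡-Reasoning
              v′ = v + w (ix zero) a

    module _ (R : I → A → A → Set) (R-refl : ∀ x a → R x a a) (R-flip : ∀ x a → R x (flip x a) a) where

      flipAll-related : ∀ {m} (ix : Fin m → I) as p → R (ix p) (lookup (flipAll ix as) p) (lookup as p)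
      flipAll-related ix (a ∷ as) zero = R-flip (ix zero) a
      flipAll-related ix (a ∷ as) (suc p) = flipAll-related (ix ∘ suc) as p

      reflect-related : ∀ {m} v (ix : Fin m → I) as p → R (ix p) (lookup (reflect v ix as) p) (lookup as p)
      reflect-related v ix (a ∷ as) p with v ℤ.≟ L
      ... | yes _ = flipAll-related ix (a ∷ as) p
      reflect-related v ix (a ∷ as) zero | no _ = R-refl (ix zero) a
      reflect-related v ix (a ∷ as) (suc p) | no _ = reflect-related _ (ix ∘ suc) as p

    module _ (w-flip : ∀ x a → w x (flip x a) ≡ - w x a) (w≤1 : ∀ x a → w x a ≤ 1ℤ) where

      weight-flipAll : ∀ {m} (ix : Fin m → I) as → weight ix (flipAll ix as) ≡ - weight ix as
      weight-flipAll ix [] = refl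
      weight-flipAll ix (a ∷ as) =
        trans (cong₂ _+_ (w-flip (ix zero) a) (weight-flipAll (ix ∘ suc) as))
              (sym (ℤP.neg-distrib-+ (w (ix zero) a) _))

      -- Steps are at most 1, so a walk from at most L to above L passes through L.
      weight-reflect : ∀ {m} v (ix : Fin m → I) as → v ≤ L → L < v + weight ix as →
        v + weight ix (reflect v ix as) ≡ (L + L) - (v + weight ix as)
      weight-reflect v ix [] v≤L L<v+0 = ⊥-elim (ℤP.<⇒≱ (subst (L <_) (ℤP.+-identityʳ v) L<v+0) v≤L)
      weight-reflect v ix (a ∷ as) v≤L L<end with v ℤ.≟ L
      ... | yes refl = begin
        v + weight ix (flipAll ix (a ∷ as)) ≡⟨ cong (λ z → v + z) (weight-flipAll ix (a ∷ as)) ⟩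
        v + - W                             ≡⟨ reflection v W ⟩
        (v + v) - (v + W)                   ∎
        where open ≡-Reasoning
              W = weight ix (a ∷ as)
              reflection : ∀ v W → v + - W ≡ (v + v) - (v + W)
              reflection = solve-∀
      ... | no v≢L = begin
        v + (s + weight (ix ∘ suc) (reflect v′ (ix ∘ suc) as)) ≡⟨ sym (ℤP.+-assoc v s _) ⟩
        v′ + weight (ix ∘ suc) (reflect v′ (ix ∘ suc) as)      ≡⟨ weight-reflect v′ (ix ∘ suc) as v′≤L L<end′ ⟩
        (L + L) - (v′ + W)                                     ≡⟨ cong (λ t → (L + L) - t) (ℤP.+-assoc v s W) ⟩
        (L + L) - (v + (s + W))                                ∎
        where
        open ≡-Reasoning
        s = w (ix zero) a
        v′ = v + s
        W = weight (ix ∘ suc) as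
        v′≤L : v′ ≤ L
        v′≤L = ℤP.≤-trans (ℤP.+-monoʳ-≤ v (w≤1 (ix zero) a))
                 (subst (_≤ L) (ℤP.+-comm 1ℤ v) (ℤP.i<j⇒suc[i]≤j (ℤP.≤∧≢⇒< v≤L v≢L)))
        L<end′ : L < v′ + W
        L<end′ = subst (L <_) (sym (ℤP.+-assoc v s W)) L<end

  module Transposition {n} (i j : Fin n) where

    τ : Fin n → Fin n
    τ = PC.transpose i j

    τ-i : τ i ≡ j
    τ-i with i ≟ i
    ... | yes _ = refl
    ... | no i≢i = ⊥-elim (i≢i refl)

    τ-j : τ j ≡ i
    τ-j with j ≟ i
    ... | yes j≡i = j≡i
    ... | no _ with j ≟ j
    ...   | yes _ = refl
    ...   | no j≢j = ⊥-elim (j≢j refl)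

    τ-other : ∀ {k} → k ≢ i → k ≢ j → τ k ≡ k
    τ-other {k} k≢i k≢j with k ≟ i
    ... | yes k≡i = ⊥-elim (k≢i k≡i)
    ... | no _ with k ≟ j
    ...   | yes k≡j = ⊥-elim (k≢j k≡j)
    ...   | no _ = refl

    τ-involutive : ∀ k → τ (τ k) ≡ k
    τ-involutive k with k ≟ i
    ... | yes refl = τ-j
    ... | no k≢i with k ≟ j
    ...   | yes refl = τ-i
    ...   | no k≢j = τ-other k≢i k≢j

    swapEntries : ∀ {A : Set} → Vec A n → Vec A n
    swapEntries v = tabulate (lookup v ∘ τ)

    lookup-swapEntries : ∀ {A : Set} (v : Vec A n) k → lookup (swapEntries v) k ≡ lookup v (τ k)
    lookup-swapEntries v k = lookup∘tabulate (lookup v ∘ τ) k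

    swapEntries-involutive : ∀ {A : Set} (v : Vec A n) → swapEntries (swapEntries v) ≡ v
    swapEntries-involutive v = trans (tabulate-cong λ k →
      trans (lookup-swapEntries v (τ k)) (cong (lookup v) (τ-involutive k))) (tabulate∘lookup v)

    countTrue-swapEntries : ∀ v → countTrue (swapEntries v) ≡ countTrue v
    countTrue-swapEntries v = ℤP.+-injective (begin
      + countTrue (swapEntries v)                   ≡⟨ countTrue≡∑ (swapEntries v) ⟩
      ∑[ k < n ] toℤ (lookup (swapEntries v) k)     ≡⟨ sum-cong-≗ (cong toℤ ∘ lookup-swapEntries v) ⟩
      ∑[ k < n ] toℤ (lookup v (τ k))               ≡⟨ sum-permute (toℤ ∘ lookup v) (Perm.transpose i j) ⟨
      ∑[ k < n ] toℤ (lookup v k)                   ≡⟨ countTrue≡∑ v ⟨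
      + countTrue v                                 ∎)
      where open ≡-Reasoning

  module Switching {n} (i j : Fin n) (i≢j : i ≢ j) (L : ℤ) where
    open Transposition i j

    Row : Set
    Row = Vec Bool n

    Special : Fin n → Set
    Special x = x ≡ i ⊎ x ≡ j

    -- Rows i and j are never changed: swapping their entries i and j could create a loop.
    flipRow : Fin n → Row → Row
    flipRow x r with x ≟ i ⊎-dec x ≟ j
    ... | yes _ = r
    ... | no _ = swapEntries r

    diff : Row → ℤ
    diff r = toℤ (lookup r i) - toℤ (lookup r j)

    step : Fin n → Row → ℤ
    step x r with x ≟ i ⊎-dec x ≟ j
    ... | yes _ = 0ℤ
    ... | no _ = diff r

    open Reflection flipRow step L public

    offset : Digraph n → ℤ
    offset M = diff (lookup M i) + diff (lookup M j)

    switch : Digraph n → Digraph n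
    switch M = reflect (offset M) id M

    gap : Digraph n → ℤ
    gap M = offset M + weight id M

    flipRow-involutive : ∀ x r → flipRow x (flipRow x r) ≡ r
    flipRow-involutive x r with x ≟ i ⊎-dec x ≟ j
    ... | yes _ = refl
    ... | no _ = swapEntries-involutive r

    diff-swapEntries : ∀ r → diff (swapEntries r) ≡ - diff r
    diff-swapEntries r = begin
      toℤ (lookup (swapEntries r) i) - toℤ (lookup (swapEntries r) j)
        ≡⟨ cong₂ (λ a b → toℤ a - toℤ b) (trans (lookup-swapEntries r i) (cong (lookup r) τ-i))
                                          (trans (lookup-swapEntries r j) (cong (lookup r) τ-j)) ⟩
      toℤ (lookup r j) - toℤ (lookup r i)
        ≡⟨ antisymmetric (toℤ (lookup r i)) (toℤ (lookup r j)) ⟩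
      - diff r ∎
      where
      open ≡-Reasoning
      antisymmetric : ∀ a b → b - a ≡ - (a - b)
      antisymmetric = solve-∀

    step-flipRow : ∀ x r → step x (flipRow x r) ≡ - step x r
    step-flipRow x r with x ≟ i ⊎-dec x ≟ j
    ... | yes _ = refl
    ... | no _ = diff-swapEntries r

    diff≤1 : ∀ r → diff r ≤ 1ℤ
    diff≤1 r with lookup r i | lookup r j
    ... | true  | true  = +≤+ ℕ.z≤n
    ... | true  | false = +≤+ (ℕ.s≤s ℕ.z≤n)
    ... | false | true  = -≤+
    ... | false | false = +≤+ ℕ.z≤n

    step≤1 : ∀ x r → step x r ≤ 1ℤ
    step≤1 x r with x ≟ i ⊎-dec x ≟ j
    ... | yes _ = +≤+ ℕ.z≤n
    ... | no _ = diff≤1 r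

    switch-related : (R : Fin n → Row → Row → Set) → (∀ x r → R x r r) →
      (∀ x r → R x (flipRow x r) r) → ∀ M x → R x (lookup (switch M) x) (lookup M x)
    switch-related R R-refl R-flip M = reflect-related R R-refl R-flip (offset M) id M

    switch-preserves : ∀ {B : Set} (h : Fin n → Row → B) → (∀ x r → h x (flipRow x r) ≡ h x r) →
      ∀ M x → h x (lookup (switch M) x) ≡ h x (lookup M x)
    switch-preserves h = switch-related (λ x r r′ → h x r ≡ h x r′) (λ _ _ → refl)

    switch-special : ∀ M {x} → Special x → lookup (switch M) x ≡ lookup M x
    switch-special M {x} = switch-related (λ x r r′ → Special x → r ≡ r′) (λ _ _ _ → refl) fixed M x
      where
      fixed : ∀ x r → Special x → flipRow x r ≡ r
      fixed x r s with x ≟ i ⊎-dec x ≟ j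
      ... | yes _ = refl
      ... | no ¬s = ⊥-elim (¬s s)

    offset-switch : ∀ M → offset (switch M) ≡ offset M
    offset-switch M =
      cong₂ (λ rᵢ rⱼ → diff rᵢ + diff rⱼ) (switch-special M (inj₁ refl)) (switch-special M (inj₂ refl))

    switch-involutive : ∀ M → switch (switch M) ≡ M
    switch-involutive M = trans (cong (λ v → reflect v id (switch M)) (offset-switch M))
                                (reflect-involutive flipRow-involutive (offset M) id M)

    switch-loopless : ∀ M → Loopless M → Loopless (switch M)
    switch-loopless M loopless x = trans (switch-preserves (λ x r → lookup r x) diagonal M x) (loopless x)
      where
      diagonal : ∀ x r → lookup (flipRow x r) x ≡ lookup r x
      diagonal x r with x ≟ i ⊎-dec x ≟ j
      ... | yes _ = refl
      ... | no ¬s = trans (lookup-swapEntries r x) (cong (lookup r) (τ-other (¬s ∘ inj₁) (¬s ∘ inj₂)))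

    outdeg-switch : ∀ M x → outdeg (switch M) x ≡ outdeg M x
    outdeg-switch = switch-preserves (λ _ → countTrue) preserved
      where
      preserved : ∀ x r → countTrue (flipRow x r) ≡ countTrue r
      preserved x r with x ≟ i ⊎-dec x ≟ j
      ... | yes _ = refl
      ... | no _ = countTrue-swapEntries r

    indeg-switch-other : ∀ M {k} → k ≢ i → k ≢ j → indeg (switch M) k ≡ indeg M k
    indeg-switch-other M {k} k≢i k≢j = ℤP.+-injective (begin
      + indeg (switch M) k                      ≡⟨ indeg≡∑ (switch M) k ⟩
      ∑[ x < n ] toℤ (arc (switch M) x k)
        ≡⟨ sum-cong-≗ (switch-preserves (λ _ r → toℤ (lookup r k)) preserved M) ⟩
      ∑[ x < n ] toℤ (arc M x k)                ≡⟨ indeg≡∑ M k ⟨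
      + indeg M k                               ∎)
      where
      open ≡-Reasoning
      preserved : ∀ x r → toℤ (lookup (flipRow x r) k) ≡ toℤ (lookup r k)
      preserved x r with x ≟ i ⊎-dec x ≟ j
      ... | yes _ = refl
      ... | no _ = cong toℤ (trans (lookup-swapEntries r k) (cong (lookup r) (τ-other k≢i k≢j)))

    indeg-i+j≡∑ : ∀ M → + indeg M i + + indeg M j ≡ ∑[ x < n ] (toℤ (arc M x i) + toℤ (arc M x j))
    indeg-i+j≡∑ M = trans (cong₂ _+_ (indeg≡∑ M i) (indeg≡∑ M j))
                          (sym (∑-distrib-+ (λ x → toℤ (arc M x i)) (λ x → toℤ (arc M x j))))

    indeg-i+j-switch : ∀ M → indeg (switch M) i ℕ.+ indeg (switch M) j ≡ indeg M i ℕ.+ indeg M j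
    indeg-i+j-switch M = ℤP.+-injective (begin
      + indeg (switch M) i + + indeg (switch M) j ≡⟨ indeg-i+j≡∑ (switch M) ⟩
      ∑[ x < n ] pair (lookup (switch M) x)       ≡⟨ sum-cong-≗ (switch-preserves (λ _ → pair) preserved M) ⟩
      ∑[ x < n ] pair (lookup M x)                ≡⟨ indeg-i+j≡∑ M ⟨
      + indeg M i + + indeg M j                   ∎)
      where
      open ≡-Reasoning
      pair : Row → ℤ
      pair r = toℤ (lookup r i) + toℤ (lookup r j)
      preserved : ∀ x r → pair (flipRow x r) ≡ pair r
      preserved x r with x ≟ i ⊎-dec x ≟ j
      ... | yes _ = refl
      ... | no _ = trans (cong₂ (λ a b → toℤ a + toℤ b) (trans (lookup-swapEntries r i) (cong (lookup r) τ-i))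
                                                        (trans (lookup-swapEntries r j) (cong (lookup r) τ-j)))
                         (ℤP.+-comm (toℤ (lookup r j)) _)

    ∑-diff≡gap : ∀ M → ∑[ x < n ] diff (lookup M x) ≡ gap M
    ∑-diff≡gap M = begin
      sum f                  ≡⟨ sum-isolate f i ⟩
      f i + sum f₁           ≡⟨ cong (λ z → f i + z) (sum-isolate f₁ j) ⟩
      f i + (f₁ j + sum f₂)  ≡⟨ cong (λ z → f i + (z + sum f₂)) (updateAt-minimal j i f (i≢j ∘ sym)) ⟩
      f i + (f j + sum f₂)   ≡⟨ ℤP.+-assoc (f i) (f j) (sum f₂) ⟨
      offset M + sum f₂      ≡⟨ cong (λ z → offset M + z) (sum-cong-≗ f₂≗step) ⟩
      gap M                  ∎
      where
      open ≡-Reasoning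
      f = λ x → diff (lookup M x)
      f₁ = updateAt f i (const 0ℤ)
      f₂ = updateAt f₁ j (const 0ℤ)
      f₂≗step : ∀ x → f₂ x ≡ step x (lookup M x)
      f₂≗step x with x ≟ i ⊎-dec x ≟ j
      ... | yes (inj₁ refl) = trans (updateAt-minimal i j f₁ i≢j) (updateAt-updates i f)
      ... | yes (inj₂ refl) = updateAt-updates j f₁
      ... | no ¬s = trans (updateAt-minimal x j f₁ (¬s ∘ inj₂)) (updateAt-minimal x i f (¬s ∘ inj₁))

    indeg-i≡gap+indeg-j : ∀ M → + indeg M i ≡ gap M + + indeg M j
    indeg-i≡gap+indeg-j M = begin
      + indeg M i                                   ≡⟨ indeg≡∑ M i ⟩
      ∑[ x < n ] toℤ (arc M x i)                    ≡⟨ sum-cong-≗ (λ x → split (toℤ (arc M x i)) _) ⟩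
      ∑[ x < n ] (diff (lookup M x) + toℤ (arc M x j))
        ≡⟨ ∑-distrib-+ (λ x → diff (lookup M x)) (λ x → toℤ (arc M x j)) ⟩
      ∑[ x < n ] diff (lookup M x) + ∑[ x < n ] toℤ (arc M x j)
        ≡⟨ cong₂ _+_ (sym (∑-diff≡gap M)) (indeg≡∑ M j) ⟨
      gap M + + indeg M j                           ∎
      where
      open ≡-Reasoning
      split : ∀ a b → a ≡ (a - b) + b
      split = solve-∀

    offset≤1 : ∀ M → Loopless M → offset M ≤ 1ℤ
    offset≤1 M loopless rewrite loopless i | loopless j with arc M i j | arc M j i
    ... | true  | true  = +≤+ ℕ.z≤n
    ... | true  | false = -≤+
    ... | false | true  = +≤+ (ℕ.s≤s ℕ.z≤n)
    ... | false | false = +≤+ ℕ.z≤n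

    gap-switch : ∀ M → offset M ≤ L → L < gap M → gap (switch M) ≡ (L + L) - gap M
    gap-switch M below above = trans (cong (_+ weight id (switch M)) (offset-switch M))
      (weight-reflect step-flipRow step≤1 (offset M) id M below above)

  smaller-from-gap-and-sum : ∀ {X Y e Z} → X ≡ e ℕ.+ Y → X ℕ.+ Y ≡ e ℕ.+ 2 ℕ.* Z → Y ≡ Z
  smaller-from-gap-and-sum {X} {Y} {e} {Z} X≡e+Y X+Y≡ = ℕP.*-cancelˡ-≡ Y Z 2 (ℕP.+-cancelˡ-≡ e _ _ (begin
    e ℕ.+ 2 ℕ.* Y   ≡⟨ regroup e Y ⟩
    e ℕ.+ Y ℕ.+ Y   ≡⟨ cong (ℕ._+ Y) X≡e+Y ⟨
    X ℕ.+ Y         ≡⟨ X+Y≡ ⟩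
    e ℕ.+ 2 ℕ.* Z   ∎))
    where
    open ≡-Reasoning
    regroup : ∀ e Y → e ℕ.+ 2 ℕ.* Y ≡ e ℕ.+ Y ℕ.+ Y
    regroup = ℕ-Solver.solve-∀

  module _ {n} {c′ c : DegList n} (t : RobinHood c′ c) where
    open RobinHood t
    private
      e : ℕ
      e = proj₁ (ℕP.m≤n⇒∃[o]m+o≡n to≤from)
      c-to+e≡c-from : lookup c to ℕ.+ e ≡ lookup c from
      c-to+e≡c-from = proj₂ (ℕP.m≤n⇒∃[o]m+o≡n to≤from)
    open Switching from to from≢to (+ suc e) hiding (switch; switch-involutive)
    open Switching from to from≢to (+ suc e) public using (switch; switch-involutive)

    c′-from≡ : lookup c′ from ≡ suc (suc (lookup c′ to) ℕ.+ e)
    c′-from≡ = trans from-decreases (cong suc (trans (sym c-to+e≡c-from) (cong (ℕ._+ e) to-increases)))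

    c′-from+c′-to≡ : lookup c′ from ℕ.+ lookup c′ to ≡ e ℕ.+ 2 ℕ.* lookup c to
    c′-from+c′-to≡ = begin
      lookup c′ from ℕ.+ B             ≡⟨ cong (ℕ._+ B) c′-from≡ ⟩
      suc (suc B ℕ.+ e) ℕ.+ B          ≡⟨ regroup B e ⟩
      e ℕ.+ 2 ℕ.* suc B                ≡⟨ cong (λ z → e ℕ.+ 2 ℕ.* z) to-increases ⟨
      e ℕ.+ 2 ℕ.* lookup c to          ∎
      where
      open ≡-Reasoning
      B = lookup c′ to
      regroup : ∀ B e → suc (suc B ℕ.+ e) ℕ.+ B ≡ e ℕ.+ 2 ℕ.* suc B
      regroup = ℕ-Solver.solve-∀

    module _ (M : Digraph n) (loopless : Loopless M) (indeg-M : ∀ k → indeg M k ≡ lookup c′ k) where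

      gap≡ : gap M ≡ + suc (suc e)
      gap≡ = begin
        gap M                                      ≡⟨ cancel (gap M) (+ indeg M to) ⟩
        (gap M + + indeg M to) - + indeg M to      ≡⟨ cong (_- + indeg M to) (indeg-i≡gap+indeg-j M) ⟨
        + indeg M from - + indeg M to
          ≡⟨ cong₂ (λ a b → + a - + b) (trans (indeg-M from) c′-from≡) (indeg-M to) ⟩
        + suc (suc B ℕ.+ e) - + B                  ≡⟨ difference (+ e) (+ B) ⟩
        + suc (suc e)                              ∎
        where
        open ≡-Reasoning
        B = lookup c′ to
        cancel : ∀ d b → d ≡ (d + b) - b
        cancel = solve-∀
        difference : ∀ x y → (1ℤ + ((1ℤ + y) + x)) - y ≡ 1ℤ + (1ℤ + x)
        difference = solve-∀

      gap-switch≡ : gap (switch M) ≡ + e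
      gap-switch≡ = trans (gap-switch M below above)
                          (trans (cong (λ g → (+ suc e + + suc e) - g) gap≡) (reflected (+ e)))
        where
        below = ℤP.≤-trans (offset≤1 M loopless) (+≤+ (ℕ.s≤s ℕ.z≤n))
        above = subst (+ suc e <_) (sym gap≡) (+<+ (ℕP.n<1+n _))
        reflected : ∀ x → ((1ℤ + x) + (1ℤ + x)) - (1ℤ + (1ℤ + x)) ≡ x
        reflected = solve-∀

      indeg-switch-from≡e+to : indeg (switch M) from ≡ e ℕ.+ indeg (switch M) to
      indeg-switch-from≡e+to = ℤP.+-injective
        (trans (indeg-i≡gap+indeg-j (switch M)) (cong (_+ + indeg (switch M) to) gap-switch≡))

      indeg-switch-to : indeg (switch M) to ≡ lookup c to
      indeg-switch-to = smaller-from-gap-and-sum indeg-switch-from≡e+to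
        (trans (indeg-i+j-switch M) (trans (cong₂ ℕ._+_ (indeg-M from) (indeg-M to)) c′-from+c′-to≡))

      indeg-switch-from : indeg (switch M) from ≡ lookup c from
      indeg-switch-from = trans indeg-switch-from≡e+to
        (trans (cong (e ℕ.+_) indeg-switch-to) (trans (ℕP.+-comm e _) c-to+e≡c-from))

    switch-realizes : ∀ {b} M → IsRealization c′ b M → IsRealization c b (switch M)
    switch-realizes M (loopless , indeg-M , outdeg-M) =
      switch-loopless M loopless , indeg-switch , λ x → trans (outdeg-switch M x) (outdeg-M x)
      where
      indeg-switch : ∀ k → indeg (switch M) k ≡ lookup c k
      indeg-switch k with k ≟ from | k ≟ to
      ... | yes refl | _ = indeg-switch-from M loopless indeg-M
      ... | no _ | yes refl = indeg-switch-to M loopless indeg-M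
      ... | no k≢from | no k≢to =
        trans (indeg-switch-other M k≢from k≢to) (trans (indeg-M k) (sym (others-unchanged k k≢from k≢to)))

open ColumnSwitching using (switch; switch-realizes; switch-involutive)

N₂-RobinHood : ∀ {n} {c′ c : DegList n} b → RobinHood c′ c → N₂ c′ b ℕ.≤ N₂ c b
N₂-RobinHood {c′ = c′} {c} b t =
  N₂-mono-by-injection {a = c′} {b} {c} {b} (switch t) switch-injective (switch-realizes t {b})
  where
  switch-injective : Injective _≡_ _≡_ (switch t)
  switch-injective {M} {M′} eq =
    trans (sym (switch-involutive t M)) (trans (cong (switch t) eq) (switch-involutive t M′))

-- Majorization as a chain of Robin Hood transfers

open import Data.Nat using (_+_; _∸_; _≤_; _<_; s≤s; z≤n; _<?_)
open import Data.Nat.Properties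
import Data.Fin.Properties as FinP
open import Data.Vec using (toList; updateAt)
open import Data.Vec.Properties using (lookup∘updateAt; lookup∘updateAt′; length-toList)
open import Data.List.Properties using (take-all)
open import Data.Nat.ListAction using (sum)

liftRobinHood : ∀ {n} x {c′ c : DegList n} → RobinHood c′ c → RobinHood (x ∷ c′) (x ∷ c)
liftRobinHood x t = record
  { from = suc from ; to = suc to ; from≢to = from≢to ∘ FinP.suc-injective
  ; from-decreases = from-decreases ; to-increases = to-increases
  ; others-unchanged = λ { zero _ _ → refl
                         ; (suc k) k≢from k≢to → others-unchanged k (k≢from ∘ cong suc) (k≢to ∘ cong suc) }
  ; to≤from = to≤from }
  where open RobinHood t

-- a ≺[ e ] a′: every prefix sum of a is at most e plus the one of a′, with equality for the whole
-- vector; the cons constructor records the credit e′ left after the heads.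
data _≺[_]_ : ∀ {m} → Vec ℕ m → ℕ → Vec ℕ m → Set where
  [] : [] ≺[ 0 ] []
  _∷_ : ∀ {e e′ y y′ m} {ys ys′ : Vec ℕ m} → e + y′ ≡ y + e′ → ys ≺[ e′ ] ys′ → (y ∷ ys) ≺[ e ] (y′ ∷ ys′)

deficit-position : ∀ {m d} {ys ys′ : Vec ℕ m} → ys ≺[ suc d ] ys′ →
  Σ (Fin m) λ p → lookup ys′ p < lookup ys p × ys ≺[ d ] updateAt ys′ p suc
deficit-position {d = d} {y ∷ ys} {y′ ∷ ys′} (_∷_ {e′ = e′} eq rest) with y′ <? y
... | yes y′<y = zero , y′<y , trans (+-suc d y′) eq ∷ rest
... | no y′≮y with e′
...   | zero = ⊥-elim (y′≮y (subst (y′ <_) (trans eq (+-identityʳ y)) (s≤s (m≤n+m y′ d))))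
...   | suc e″ with deficit-position rest
...     | p , lt , rest′ = suc p , lt , suc-injective (trans eq (+-suc y e″)) ∷ rest′

Nonincreasing-tail : ∀ {m} x (as : Vec ℕ m) → Nonincreasing (x ∷ as) → Nonincreasing as
Nonincreasing-tail x as ni p q p≤q = ni (suc p) (suc q) (s≤s p≤q)

mutual
  ≺[0]⇒RobinHood* : ∀ {m} {a a′ : Vec ℕ m} → Nonincreasing a → a ≺[ 0 ] a′ → Star RobinHood a′ a
  ≺[0]⇒RobinHood* ni [] = ε
  ≺[0]⇒RobinHood* {a = x ∷ as} {x′ ∷ as′} ni (_∷_ {e′ = e} eq rest) =
    subst (λ z → Star RobinHood (z ∷ as′) (x ∷ as)) (sym eq) (redistribute-head x e ni rest)

  -- The surplus d of the head of a′ over x is handed out one unit at a time, each time to an entry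
  -- where a′ is still below a.
  redistribute-head : ∀ {m} x d {as as′ : Vec ℕ m} → Nonincreasing (x ∷ as) → as ≺[ d ] as′ →
    Star RobinHood (x + d ∷ as′) (x ∷ as)
  redistribute-head x zero {as} {as′} ni rest =
    subst (λ z → Star RobinHood (z ∷ as′) (x ∷ as)) (sym (+-identityʳ x))
          (gmap (x ∷_) (liftRobinHood x) (≺[0]⇒RobinHood* (Nonincreasing-tail x as ni) rest))
  redistribute-head x (suc d) {as} {as′} ni rest with deficit-position rest
  ... | p , as′ₚ<asₚ , rest′ = transfer ◅ redistribute-head x d ni rest′
    where
    transfer : RobinHood (x + suc d ∷ as′) (x + d ∷ updateAt as′ p suc)
    transfer = record
      { from = zero ; to = suc p ; from≢to = FinP.0≢1+n ; from-decreases = +-suc x d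
      ; to-increases = lookup∘updateAt p as′
      ; others-unchanged = λ { zero 0≢0 _ → ⊥-elim (0≢0 refl)
                             ; (suc k) _ k≢p → lookup∘updateAt′ k p (k≢p ∘ cong suc) as′ }
      ; to≤from = ≤-trans (≤-reflexive (lookup∘updateAt p as′))
                  (≤-trans as′ₚ<asₚ (≤-trans (ni zero (suc p) z≤n) (m≤m+n x d))) }

prefix-sums⇒≺[_] : ∀ {m} e (a a′ : Vec ℕ m) →
  (∀ k → psum k a ≤ e + psum k a′) → total a ≡ e + total a′ → a ≺[ e ] a′
prefix-sums⇒≺[ e ] [] [] _ total≡ = subst ([] ≺[_] []) (trans total≡ (+-identityʳ e)) []
prefix-sums⇒≺[ e ] (y ∷ ys) (y′ ∷ ys′) psum≤ total≡ = eq ∷ prefix-sums⇒≺[ e′ ] ys ys′ psum≤′ total≡′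
  where
  y≤e+y′ : y ≤ e + y′
  y≤e+y′ = subst₂ _≤_ (+-identityʳ y) (cong (e +_) (+-identityʳ y′)) (psum≤ 1)
  e′ = (e + y′) ∸ y
  eq : e + y′ ≡ y + e′
  eq = sym (m+[n∸m]≡n y≤e+y′)
  shift : ∀ s → e + (y′ + s) ≡ y + (e′ + s)
  shift s = trans (sym (+-assoc e y′ s)) (trans (cong (_+ s) eq) (+-assoc y e′ s))
  psum≤′ : ∀ k → psum k ys ≤ e′ + psum k ys′
  psum≤′ k = +-cancelˡ-≤ y _ _ (subst (psum (suc k) (y ∷ ys) ≤_) (shift (psum k ys′)) (psum≤ (suc k)))
  total≡′ : total ys ≡ e′ + total ys′
  total≡′ = +-cancelˡ-≡ y _ _ (trans total≡ (shift (total ys′)))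

psum-all : ∀ {n} k (a : Vec ℕ n) → n ≤ k → psum k a ≡ total a
psum-all k a n≤k = cong sum (take-all k (toList a) (subst (_≤ k) (sym (length-toList a)) n≤k))

≺⇒≺[0] : ∀ {n} {a a′ : Vec ℕ n} → a ≺ a′ → a ≺[ 0 ] a′
≺⇒≺[0] {n} {a} {a′} (psum≤ , total≡) = prefix-sums⇒≺[ 0 ] a a′ psum≤′ total≡
  where
  psum≤′ : ∀ k → psum k a ≤ psum k a′
  psum≤′ zero = z≤n
  psum≤′ (suc k) with suc k <? n
  ... | yes k<n = psum≤ (suc k) (s≤s z≤n) k<n
  ... | no k≮n = ≤-reflexive
    (trans (psum-all (suc k) a (≮⇒≥ k≮n)) (trans total≡ (sym (psum-all (suc k) a′ (≮⇒≥ k≮n)))))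

corollary4 : ∀ (n : ℕ) (a a' b : DegList n) →
    Digraphic a b → Digraphic a' b → ¬ (a ≡ a') →
    Nonincreasing a → a ≺ a' →
    N₂ a' b ≤ N₂ a b
corollary4 n a a' b _ _ _ a-nonincreasing a≺a' =
  fold (λ c′ c → N₂ c′ b ≤ N₂ c b) (λ t → ≤-trans (N₂-RobinHood b t)) ≤-refl
       (≺[0]⇒RobinHood* a-nonincreasing (≺⇒≺[0] a≺a'))
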